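{- Let $T$ be a maximal consistent set of formulas. Then: (1) for every formula $\alpha$, exactly one of $\alpha,\neg\alpha$ is in $T$; (2) $T$ is deductively closed; (3) $\alpha\wedge\beta\in T$ iff $\alpha\in T$ and $\beta\in T$; (4) if $\{\alpha,\alpha\to\beta\}\subseteq T$ then $\beta\in T$; (5) if $N_k(\mathcal B,\mathcal X,\neg((\bigwedge_{l=0}^{i-1}\bigcirc^l\alpha)\wedge\bigcirc^i\beta))\in T$ for all $i\in\mathbb N$, then $N_k(\mathcal B,\mathcal X,\neg(\alpha\mathsf U\beta))\in T$; (6) if $N_k(\mathcal B,\mathcal X,\neg((\bigwedge_{l=0}^{i-1}\ominus^l\alpha)\wedge(\bigwedge_{l=0}^{i}\neg\ominus^l(\alpha\wedge\neg\alpha))\wedge\ominus^i\beta))\in T$ for all $i\in\mathbb N$, then $N_k(\mathcal B,\mathcal X,\neg(\alpha\mathsf S\beta))\in T$; (7) if $N_k(\mathcal B,\mathcal X,E^i\alpha)\in T$ for all $i\in\mathbb N$, then $N_k(\mathcal B,\mathcal X,C\alpha)\in T$; (8) if $r=\sup\{s\in\mathbb Q\cap[0,1]:P_{\geqslant s}\alpha\in T\}$ and $r$ is rational, then $P_{\geqslant r}\alpha\in T$; (9) if $r=\sup\{s\in\mathbb Q\cap[0,1]:P_{\geqslant s}\alpha\in T\}$, then $P_{\geqslant s}\alpha\in T$ for every rational $s<r$; (10) if $r=\sup\{s:P_{a,\geqslant s}\alpha\in T\}$ and $r$ is rational, then $P_{a,\geqslant r}\alpha\in T$; (11) if $r=\sup\{s:P_{a,\geqslant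 s}\alpha\in T\}$, then $P_{a,\geqslant s}\alpha\in T$ for every rational $s<r$; (12) there is a positive $i\in\mathbb N$ such that $\ominus^i(\alpha\wedge\neg\alpha)\in T$ for every formula $\alpha$, and $\ominus^j(\alpha\wedge\neg\alpha)\notin T$ for every $j<i$; (13) $T^{ -\bigcirc}=\{\alpha:\bigcirc\alpha\in T\}$ is maximal consistent; (14) if $\ominus(\alpha\wedge\neg\alpha)\notin T$ for every $\alpha$, then $T^{ -\ominus}=\{\alpha:\ominus\alpha\in T\}$ is maximal consistent; (15) if $\ominus(\alpha\wedge\neg\alpha)\notin T$ for every $\alpha$, then $T=(T^{ -\ominus})^{ -\bigcirc}$; (16) if $K_a\alpha\notin T$, then $T^{ -K_a}\cup\{\neg\alpha\}$ is consistent, where $T^{ -K_a}=\{\beta:K_a\beta\in T\}$.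
   Context: Setting (PTEL). Formulas are built from propositional letters (including $A_a$, "agent $a$ is active", for each agent $a$ of a finite set $\mathcal A$) with $\neg,\wedge$, unary $\bigcirc$ (next), $\ominus$ (previous), $K_a$, $C$ (common knowledge), $P_{\geqslant s}$, $P_{a,\geqslant s}$ ($s$ rational in $[0,1]$) and binary $\mathsf U$ (until), $\mathsf S$ (since); $E\alpha=\bigwedge_aK_a\alpha$, $E^0\alpha=\alpha$, $E^{n+1}\alpha=EE^n\alpha$, $\bigcirc^n,\ominus^n$ iterations, $F\alpha=(\alpha\to\alpha)\mathsf U\alpha$, $P_{<s}\alpha=\neg P_{\geqslant s}\alpha$, $P_{\leqslant s}\alpha=P_{\geqslant1-s}\neg\alpha$ (analogously for $P_{a,\cdot}$). $k$-nested implications: for $k\in\mathbb N$, $\mathcal B=(\beta_0,\dots,\beta_k)$ formulas and $\mathcal X=(X_1,\dots,X_k)$ with $X_j\in\{K_a:a\in\mathcal A\}\cup\{\bigcirc,\ominus\}$: $N_0(\mathcal B,\mathcal X,\alpha)=\beta_0\to\alpha$, $N_k(\mathcal B,\mathcal X,\alpha)=\beta_k\to X_kN_{k-1}((\beta_0,\dots,\beta_{k-1}),(X_1,\dots,X_{k-1}),\alpha)$. Axiom system $\mathrm{Ax}$: propositional tautologies, modus ponens; temporal axioms $\neg\bigcirc\alpha\leftrightarrow\bigcirc\neg\alpha$, $\bigcirc(\alpha\to\beta)\to(\bigcirc\alpha\to\bigcirc\beta)$, $\alpha\mathsf U\beta\leftrightarrow\beta\vee(\alpha\wedge\bigcirc(\alpha\mathsf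 U\beta))$, $\alpha\mathsf U\beta\to F\beta$, $\neg\ominus\neg\alpha\to\ominus\alpha$, $\ominus(\alpha\to\beta)\to(\ominus\alpha\to\ominus\beta)$, $(\ominus\alpha\wedge\ominus\beta)\to\ominus(\alpha\wedge\beta)$, $\bigcirc\ominus\alpha\leftrightarrow\alpha$, $\bigcirc\ominus\alpha\to\ominus\bigcirc\alpha$, $\neg\ominus(\gamma\wedge\neg\gamma)\to(\bigcirc\ominus\alpha\leftrightarrow\ominus\bigcirc\alpha)$, $\alpha\mathsf S\beta\leftrightarrow[\beta\vee(\neg\ominus(\alpha\wedge\neg\alpha)\wedge[\alpha\wedge\ominus(\alpha\mathsf S\beta)])]$, $(\ominus\beta\to\ominus\beta)\,\mathsf S\,\ominus\beta$; necessitation for $\bigcirc,\ominus$; infinitary rules R$\mathsf U$ (from all the premises in (5) infer its conclusion) and R$\mathsf S$ (from all the premises in (6) infer its conclusion); epistemic axioms $K_a(\alpha\to\beta)\to(K_a\alpha\to K_a\beta)$, $A_a\to(K_a\alpha\to\alpha)$, $A_a\to K_aA_a$, $\neg A_a\to K_a(\alpha\wedge\neg\alpha)$, $K_a\neg\alpha\to K_a\neg K_a\alpha$, $K_a\alpha\to K_aK_a\alpha$, $C\alpha\to E^m\alpha$, necessitation for $K_a$, rule RC (from all premises in (7) infer its conclusion); probabilistic axioms for $P$: $P_{\geqslant0}\alpha$, $P_{\leqslant r}\alpha\to P_{<t}\alpha$ ($t>r$), $P_{<t}\alpha\to P_{\leqslant t}\alpha$, $(P_{\geqslant r}\alpha\wedge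 P_{\geqslant t}\beta\wedge P_{\geqslant1}\neg(\alpha\wedge\beta))\to P_{\geqslant\min(1,r+t)}(\alpha\vee\beta)$, $(P_{\leqslant r}\alpha\wedge P_{<t}\alpha)\to P_{<r+t}(\alpha\vee\beta)$ ($r+t\leqslant1$), $P_{\geqslant1}\ominus(\alpha\wedge\neg\alpha)$, necessitation $\alpha/P_{\geqslant1}\alpha$, Archimedean rule (from $N_k(\mathcal B,\mathcal X,P_{\geqslant r-1/i}\alpha)$ for all $i\geqslant1/r$ infer $N_k(\mathcal B,\mathcal X,P_{\geqslant r}\alpha)$, $r\in(0,1]\cap\mathbb Q$); the same for $P_{a,\cdot}$ except the axiom $P_{\geqslant1}\ominus(\alpha\wedge\neg\alpha)$. Derivations have at most countable successor-ordinal length, and necessitation rules apply only to theorems. A set is consistent if it does not derive every formula; maximal consistent if consistent with no consistent proper superset; deductively closed if it contains everything it derives. -}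

module Defs where

open import Level using (Level) renaming (suc to lsuc; zero to lzero)
open import Data.Nat as ℕ using (ℕ; zero; suc)
open import Data.Fin using (Fin)
open import Data.Bool using (Bool; true; false; not) renaming (_∧_ to _&&_)
open import Data.Rational using (ℚ; 0ℚ; 1ℚ; _≤_; _<_; _+_; _-_; _*_; _⊓_; _/_)
open import Data.Integer using (+_)
open import Data.List using (List; []; _∷_; map; _++_; upTo)
open import Data.Vec using (Vec; []; _∷_; tabulate)
open import Data.Product using (Σ; ∃; _×_; _,_)
open import Data.Empty using (⊥)
open import Relation.Nullary using (¬_)
open import Relation.Binary.PropositionalEquality using (_≡_)

Agent : ℕ → Set
Agent n = Fin (suc n)

InUnit : ℚ → Set
InUnit s = 0ℚ ≤ s × s ≤ 1ℚ

data PIdx (n : ℕ) : Set where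
  glob : PIdx n
  ag   : Agent n → PIdx n

infixr 6 _∧'_

data Form (n : ℕ) : Set where
  var  : ℕ → Form n
  act  : Agent n → Form n
  ~_   : Form n → Form n
  _∧'_ : Form n → Form n → Form n
  ○    : Form n → Form n
  ⊖    : Form n → Form n
  K    : Agent n → Form n → Form n
  C    : Form n → Form n
  P    : PIdx n → (s : ℚ) → .(InUnit s) → Form n → Form n
    -- P glob s α = P_{≥s} α ;  P (ag a) s α = P_{a,≥s} α
  _U_  : Form n → Form n → Form n
  _S_  : Form n → Form n → Form n

module _ {n : ℕ} where

  infixr 5 _∨'_
  infixr 4 _⇒_
  infix  3 _⇔'_

  _⇒_ : Form n → Form n → Form n
  a ⇒ b = ~ (a ∧' ~ b)

  _∨'_ : Form n → Form n → Form n
  a ∨' b = ~ (~ a ∧' ~ b)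

  _⇔'_ : Form n → Form n → Form n
  a ⇔' b = (a ⇒ b) ∧' (b ⇒ a)

  Fut : Form n → Form n
  Fut α = (α ⇒ α) U α

  ○^ : ℕ → Form n → Form n
  ○^ zero α = α
  ○^ (suc i) α = ○ (○^ i α)

  ⊖^ : ℕ → Form n → Form n
  ⊖^ zero α = α
  ⊖^ (suc i) α = ⊖ (⊖^ i α)

  conjV : ∀ {m} → Vec (Form n) (suc m) → Form n
  conjV (x ∷ []) = x
  conjV (x ∷ y ∷ xs) = x ∧' conjV (y ∷ xs)

  E : Form n → Form n
  E α = conjV (tabulate (λ a → K a α))

  E^ : ℕ → Form n → Form n
  E^ zero α = α
  E^ (suc i) α = E (E^ i α)

  P< : PIdx n → (s : ℚ) → .(InUnit s) → Form n → Form n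
  P< π s p α = ~ P π s p α

  P≤ : PIdx n → (s : ℚ) → .(InUnit (1ℚ - s)) → Form n → Form n
  P≤ π s p α = P π (1ℚ - s) p (~ α)

  data Op : Set where
    Kop : Agent n → Op
    nxt : Op
    prv : Op

  applyOp : Op → Form n → Form n
  applyOp (Kop a) φ = K a φ
  applyOp nxt φ = ○ φ
  applyOp prv φ = ⊖ φ

  -- k-nested implication.  B = (β_k , … , β_0), X = (X_k , … , X_1)
  -- (head of the vector is the outermost component).
  N : ∀ k → Vec (Form n) (suc k) → Vec Op k → Form n → Form n
  N zero (b ∷ []) [] α = b ⇒ α
  N (suc k) (b ∷ bs) (x ∷ xs) α = b ⇒ applyOp x (N k bs xs α)

  conjs : List (Form n) → Form n → Form n
  conjs [] φ = φ
  conjs (x ∷ xs) φ = x ∧' conjs xs φ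

  premU : ℕ → Form n → Form n → Form n
  premU i α β = conjs (map (λ l → ○^ l α) (upTo i)) (○^ i β)

  premS : ℕ → Form n → Form n → Form n
  premS i α β =
    conjs (map (λ l → ⊖^ l α) (upTo i) ++ map (λ l → ~ ⊖^ l (α ∧' ~ α)) (upTo (suc i)))
          (⊖^ i β)

  -- propositional tautologies (instances): true under every Boolean
  -- valuation of the maximal non-{¬,∧} subformulas

  ev : (Form n → Bool) → Form n → Bool
  ev v (~ a) = not (ev v a)
  ev v (a ∧' b) = ev v a && ev v b
  ev v φ = v φ

  Taut : Form n → Set
  Taut φ = ∀ v → ev v φ ≡ true

  data Ax : Form n → Set where
    taut : ∀ {φ} → Taut φ → Ax φ
    t1  : ∀ α → Ax ((~ ○ α) ⇔' ○ (~ α))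
    t2  : ∀ α β → Ax (○ (α ⇒ β) ⇒ (○ α ⇒ ○ β))
    t3  : ∀ α β → Ax ((α U β) ⇔' (β ∨' (α ∧' ○ (α U β))))
    t4  : ∀ α β → Ax ((α U β) ⇒ Fut β)
    t5  : ∀ α → Ax ((~ ⊖ (~ α)) ⇒ ⊖ α)
    t6  : ∀ α β → Ax (⊖ (α ⇒ β) ⇒ (⊖ α ⇒ ⊖ β))
    t7  : ∀ α β → Ax ((⊖ α ∧' ⊖ β) ⇒ ⊖ (α ∧' β))
    t8  : ∀ α → Ax (○ (⊖ α) ⇔' α)
    t9  : ∀ α → Ax (○ (⊖ α) ⇒ ⊖ (○ α))
    t10 : ∀ α γ → Ax ((~ ⊖ (γ ∧' ~ γ)) ⇒ (○ (⊖ α) ⇔' ⊖ (○ α)))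
    t11 : ∀ α β → Ax ((α S β) ⇔' (β ∨' ((~ ⊖ (α ∧' ~ α)) ∧' (α ∧' ⊖ (α S β)))))
    t12 : ∀ β → Ax ((⊖ β ⇒ ⊖ β) S ⊖ β)
    e1 : ∀ a α β → Ax (K a (α ⇒ β) ⇒ (K a α ⇒ K a β))
    e2 : ∀ a α → Ax (act a ⇒ (K a α ⇒ α))
    e3 : ∀ a → Ax (act a ⇒ K a (act a))
    e4 : ∀ a α → Ax ((~ act a) ⇒ K a (α ∧' ~ α))
    e5 : ∀ a α → Ax (K a (~ α) ⇒ K a (~ K a α))
    e6 : ∀ a α → Ax (K a α ⇒ K a (K a α))
    e7 : ∀ α m → Ax (C α ⇒ E^ m α)
    p1 : ∀ π α .(p0 : InUnit 0ℚ) → Ax (P π 0ℚ p0 α)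
    p2 : ∀ π α r t .(pr : InUnit (1ℚ - r)) .(pt : InUnit t) → r < t →
         Ax (P≤ π r pr α ⇒ P< π t pt α)
    p3 : ∀ π α t .(pt : InUnit t) .(pt' : InUnit (1ℚ - t)) →
         Ax (P< π t pt α ⇒ P≤ π t pt' α)
    p4 : ∀ π α β r t .(pr : InUnit r) .(pt : InUnit t) .(p1 : InUnit 1ℚ)
           .(pu : InUnit (1ℚ ⊓ (r + t))) →
         Ax ((P π r pr α ∧' P π t pt β ∧' P π 1ℚ p1 (~ (α ∧' β)))
               ⇒ P π (1ℚ ⊓ (r + t)) pu (α ∨' β))
    p5 : ∀ π α β r t .(pr : InUnit (1ℚ - r)) .(pt : InUnit t) .(pu : InUnit (r + t)) →
         r + t ≤ 1ℚ →
         Ax ((P≤ π r pr α ∧' P< π t pt β) ⇒ P< π (r + t) pu (α ∨' β))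
    p6 : ∀ α .(p1 : InUnit 1ℚ) → Ax (P glob 1ℚ p1 (⊖ (α ∧' ~ α)))

  -- Derivations from a set T (well-founded, possibly infinitely
  -- branching derivation trees).  Necessitation only for theorems.

  ∅ : Form n → Set
  ∅ _ = ⊥

  infix 2 _⊢_

  data _⊢_ : (Form n → Set) → Form n → Set₁ where
    hyp  : ∀ {T φ} → T φ → T ⊢ φ
    ax   : ∀ {T φ} → Ax φ → T ⊢ φ
    mp   : ∀ {T φ ψ} → T ⊢ φ → T ⊢ (φ ⇒ ψ) → T ⊢ ψ
    nec○ : ∀ {T φ} → ∅ ⊢ φ → T ⊢ ○ φ
    nec⊖ : ∀ {T φ} → ∅ ⊢ φ → T ⊢ ⊖ φ
    necK : ∀ {T φ} a → ∅ ⊢ φ → T ⊢ K a φ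
    necP : ∀ {T φ} π .(p1 : InUnit 1ℚ) → ∅ ⊢ φ → T ⊢ P π 1ℚ p1 φ
    rU   : ∀ {T} k B X α β →
           (∀ i → T ⊢ N k B X (~ premU i α β)) → T ⊢ N k B X (~ (α U β))
    rS   : ∀ {T} k B X α β →
           (∀ i → T ⊢ N k B X (~ premS i α β)) → T ⊢ N k B X (~ (α S β))
    rC   : ∀ {T} k B X α →
           (∀ i → T ⊢ N k B X (E^ i α)) → T ⊢ N k B X (C α)
    -- Archimedean rule: premises for all i ≥ 1/r, written i = suc j
    arch : ∀ {T} π k B X α r .(pr : InUnit r) → 0ℚ < r →
           (∀ j .(pj : InUnit (r - (+ 1 / suc j))) → 1ℚ ≤ r * (+ suc j / 1) →
              T ⊢ N k B X (P π (r - (+ 1 / suc j)) pj α)) →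
           T ⊢ N k B X (P π r pr α)

  Consistent : (Form n → Set) → Set₁
  Consistent T = ¬ (∀ φ → T ⊢ φ)

  MaxConsistent : (Form n → Set) → Set₁
  MaxConsistent T =
    Consistent T ×
    (∀ (T' : Form n → Set) → (∀ φ → T φ → T' φ) → Consistent T' → ∀ φ → T' φ → T φ)

  DeductivelyClosed : (Form n → Set) → Set₁
  DeductivelyClosed T = ∀ φ → T ⊢ φ → T φ

  PSet : (Form n → Set) → PIdx n → Form n → ℚ → Set
  PSet T π α s = Σ (InUnit s) (λ p → T (P π s p α))

  -- the (real) supremum of PSet T π α equals the rational r
  SupIs : (Form n → Set) → PIdx n → Form n → ℚ → Set
  SupIs T π α r =
    (∀ s → PSet T π α s → s ≤ r) ×
    (∀ t → t < r → ∃ (λ s → PSet T π α s × t < s))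

  -- the rational s is strictly below the (real) supremum of PSet T π α
  BelowSup : (Form n → Set) → PIdx n → Form n → ℚ → Set
  BelowSup T π α s = ∃ (λ s' → PSet T π α s' × s < s')

-- The infinitary rules RU, RS, RC and the Archimedean rule all conclude a
-- k-nested implication N_k(B, X, -), and this shape is closed under the two
-- operations a Henkin-style argument needs: absorbing a hypothesis φ into the
-- outermost antecedent (φ → N_k(β_k ∷ B', X, -) is N_k((φ ∧ β_k) ∷ B', X, -)
-- up to currying), and prefixing an operator X ∈ {K_a, ○, ⊖}
-- (X N_k(B, X', -) is N_{k+1}(⊤ ∷ B, X ∷ X', -) up to ⊤ → -).  The first gives
-- the deduction theorem, hence deductive closure of maximal sets and, with
-- excluded middle, completeness; the second lifts every derivation from
-- T^{-X} = {β : Xβ ∈ T} to a derivation of Xφ from T, which yields (13), (14)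
-- and (16).  The supremum properties follow from the Archimedean rule and the
-- antitonicity of P in its threshold, and (12) from the axiom
-- (⊖β → ⊖β) S ⊖β, which by rule RS forces some ⊖^i ⊥ into T.
module Submission where

open import Defs
open import Level using (0ℓ) renaming (suc to lsuc)
open import Axiom.ExcludedMiddle using (ExcludedMiddle)
open import Data.Nat using (ℕ; _<_)
open import Relation.Binary.PropositionalEquality using (_≡_)
open import Data.Product using (Σ; _×_)
open import Data.Sum using (_⊎_)
open import Relation.Nullary using (¬_)
open import Function.Bundles using (_⇔_)

open import Level using (Lift; lift; lower)
open import Data.Nat using (zero; suc; z<s)
open import Data.Nat.Properties using (anyUpTo?)
open import Data.Nat.Induction using (<-rec)
open import Data.Bool using (Bool; true; false; not) renaming (_∧_ to _&&_)
open import Data.Vec using ([]; _∷_)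
open import Data.List using (List; []; _∷_)
open import Data.Product using (_,_; proj₁; proj₂)
open import Data.Sum using (inj₁; inj₂)
open import Data.Empty using (⊥-elim)
open import Relation.Nullary using (Dec; yes; no)
open import Relation.Nullary.Decidable using (map′)
open import Relation.Binary.PropositionalEquality using (refl; cong; subst)
open import Function.Bundles using (mk⇔; module Equivalence)
open import Function.Construct.Composition using (_⇔-∘_)
open import Function.Construct.Symmetry using (⇔-sym)
open import Data.Integer using (+_)
open import Data.Rational as ℚ using (0ℚ; 1ℚ)
import Data.Rational.Properties as ℚ
open import Relation.Binary.Definitions using (tri<; tri≈; tri>)

decide : ExcludedMiddle (lsuc 0ℓ) → (A : Set) → Dec A
decide em A = map′ lower lift (em {Lift (lsuc 0ℓ) A})

Least : (ℕ → Set) → ℕ → Set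
Least Q i = Q i × (∀ j → j < i → ¬ Q j)

least-witness : {Q : ℕ → Set} → (∀ j → Dec (Q j)) → ∀ m → Q m → Σ ℕ (Least Q)
least-witness {Q} Q? = <-rec _ step
  where
  step : ∀ m → (∀ {j} → j < m → Q j → Σ ℕ (Least Q)) → Q m → Σ ℕ (Least Q)
  step m smaller qm with anyUpTo? Q? m
  ... | yes (j , j<m , qj) = smaller j<m qj
  ... | no none = m , qm , λ j j<m qj → none (j , j<m , qj)

InUnit-complement : ∀ {s} → InUnit s → InUnit (1ℚ ℚ.- s)
InUnit-complement {s} (0≤s , s≤1) =
  subst (ℚ._≤ 1ℚ ℚ.- s) (ℚ.+-inverseʳ s) (ℚ.+-monoˡ-≤ (ℚ.- s) s≤1) ,
  subst (1ℚ ℚ.- s ℚ.≤_) (ℚ.+-identityʳ 1ℚ) (ℚ.+-monoʳ-≤ 1ℚ (ℚ.neg-antimono-≤ 0≤s))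

p-1/[1+j]<p : ∀ p j → p ℚ.- (+ 1 ℚ./ suc j) ℚ.< p
p-1/[1+j]<p p j =
  subst (p ℚ.- (+ 1 ℚ./ suc j) ℚ.<_) (ℚ.+-identityʳ p)
    (ℚ.+-monoʳ-< p (ℚ.neg-antimono-<
      (ℚ.positive⁻¹ (+ 1 ℚ./ suc j) {{ℚ.normalize-pos 1 (suc j)}})))

_→ᵇ_ : Bool → Bool → Bool
x →ᵇ y = not (x && not y)

bool-cases₁ : (f : Bool → Bool) → f true ≡ true → f false ≡ true → ∀ x → f x ≡ true
bool-cases₁ f t f₀ true = t
bool-cases₁ f t f₀ false = f₀

bool-cases₂ : (f : Bool → Bool → Bool) → f true true ≡ true → f true false ≡ true →
              f false true ≡ true → f false false ≡ true → ∀ x y → f x y ≡ true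
bool-cases₂ f tt tf ft ff true = bool-cases₁ (f true) tt tf
bool-cases₂ f tt tf ft ff false = bool-cases₁ (f false) ft ff

bool-cases₃ : (f : Bool → Bool → Bool → Bool) →
              f true true true ≡ true → f true true false ≡ true →
              f true false true ≡ true → f true false false ≡ true →
              f false true true ≡ true → f false true false ≡ true →
              f false false true ≡ true → f false false false ≡ true →
              ∀ x y z → f x y z ≡ true
bool-cases₃ f ttt ttf tft tff ftt ftf fft fff true = bool-cases₂ (f true) ttt ttf tft tff
bool-cases₃ f ttt ttf tft tff ftt ftf fft fff false = bool-cases₂ (f false) ftt ftf fft fff

module _ {n : ℕ} where

  Theory : Set₁
  Theory = Form n → Set

  private variable
    T T' : Theory
    φ ψ : Form n

  ⊥ᶠ ⊤ᶠ : Form n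
  ⊥ᶠ = var 0 ∧' ~ var 0
  ⊤ᶠ = ~ ⊥ᶠ

  Ext : Theory → Form n → Theory
  Ext T φ ψ = T ψ ⊎ ψ ≡ φ

  Preimage : Op → Theory → Theory
  Preimage x T β = T (applyOp x β)

  ax-⊤ : Ax ⊤ᶠ
  ax-⊤ = taut λ v → bool-cases₁ (λ x → not (x && not x)) refl refl (ev v (var 0))

  ax-I : ∀ (a : Form n) → Ax (a ⇒ a)
  ax-I a = taut λ v → bool-cases₁ (λ x → x →ᵇ x) refl refl (ev v a)

  ax-K : ∀ (a b : Form n) → Ax (a ⇒ (b ⇒ a))
  ax-K a b = taut λ v →
    bool-cases₂ (λ x y → x →ᵇ (y →ᵇ x)) refl refl refl refl (ev v a) (ev v b)

  ax-S : ∀ (p a b : Form n) → Ax ((p ⇒ a) ⇒ ((p ⇒ (a ⇒ b)) ⇒ (p ⇒ b)))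
  ax-S p a b = taut λ v →
    bool-cases₃ (λ x y z → (x →ᵇ y) →ᵇ ((x →ᵇ (y →ᵇ z)) →ᵇ (x →ᵇ z)))
      refl refl refl refl refl refl refl refl (ev v p) (ev v a) (ev v b)

  ax-uncurry : ∀ (p a b : Form n) → Ax ((p ⇒ (a ⇒ b)) ⇒ ((p ∧' a) ⇒ b))
  ax-uncurry p a b = taut λ v →
    bool-cases₃ (λ x y z → (x →ᵇ (y →ᵇ z)) →ᵇ ((x && y) →ᵇ z))
      refl refl refl refl refl refl refl refl (ev v p) (ev v a) (ev v b)

  ax-curry : ∀ (p a b : Form n) → Ax (((p ∧' a) ⇒ b) ⇒ (p ⇒ (a ⇒ b)))
  ax-curry p a b = taut λ v →
    bool-cases₃ (λ x y z → ((x && y) →ᵇ z) →ᵇ (x →ᵇ (y →ᵇ z)))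
      refl refl refl refl refl refl refl refl (ev v p) (ev v a) (ev v b)

  ax-explosion : ∀ (a b : Form n) → Ax (a ⇒ (~ a ⇒ b))
  ax-explosion a b = taut λ v →
    bool-cases₂ (λ x y → x →ᵇ (not x →ᵇ y)) refl refl refl refl (ev v a) (ev v b)

  ax-self-refutation : ∀ (a : Form n) → Ax ((a ⇒ ~ a) ⇒ ~ a)
  ax-self-refutation a = taut λ v →
    bool-cases₁ (λ x → (x →ᵇ not x) →ᵇ not x) refl refl (ev v a)

  ax-¬¬-elim : ∀ (a : Form n) → Ax (~ ~ a ⇒ a)
  ax-¬¬-elim a = taut λ v → bool-cases₁ (λ x → not (not x) →ᵇ x) refl refl (ev v a)

  ax-∧-elimˡ : ∀ (a b : Form n) → Ax ((a ∧' b) ⇒ a)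
  ax-∧-elimˡ a b = taut λ v →
    bool-cases₂ (λ x y → (x && y) →ᵇ x) refl refl refl refl (ev v a) (ev v b)

  ax-∧-elimʳ : ∀ (a b : Form n) → Ax ((a ∧' b) ⇒ b)
  ax-∧-elimʳ a b = taut λ v →
    bool-cases₂ (λ x y → (x && y) →ᵇ y) refl refl refl refl (ev v a) (ev v b)

  ax-∧-intro : ∀ (a b : Form n) → Ax (a ⇒ (b ⇒ (a ∧' b)))
  ax-∧-intro a b = taut λ v →
    bool-cases₂ (λ x y → x →ᵇ (y →ᵇ (x && y))) refl refl refl refl (ev v a) (ev v b)

  ax-contraposition : ∀ (a b : Form n) → Ax ((a ⇒ b) ⇒ (~ b ⇒ ~ a))
  ax-contraposition a b = taut λ v →
    bool-cases₂ (λ x y → (x →ᵇ y) →ᵇ (not y →ᵇ not x)) refl refl refl refl (ev v a) (ev v b)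

  ax-contraposition-¬ʳ : ∀ (a b : Form n) → Ax ((a ⇒ ~ b) ⇒ (b ⇒ ~ a))
  ax-contraposition-¬ʳ a b = taut λ v →
    bool-cases₂ (λ x y → (x →ᵇ not y) →ᵇ (y →ᵇ not x)) refl refl refl refl (ev v a) (ev v b)

  ax-contraposition-¬ˡ : ∀ (a b : Form n) → Ax ((~ a ⇒ b) ⇒ (~ b ⇒ a))
  ax-contraposition-¬ˡ a b = taut λ v →
    bool-cases₂ (λ x y → (not x →ᵇ y) →ᵇ (not y →ᵇ x)) refl refl refl refl (ev v a) (ev v b)

  ax-⇔-elimˡ : ∀ (a b : Form n) → Ax ((a ⇔' b) ⇒ (a ⇒ b))
  ax-⇔-elimˡ a b = taut λ v →
    bool-cases₂ (λ x y → ((x →ᵇ y) && (y →ᵇ x)) →ᵇ (x →ᵇ y))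
      refl refl refl refl (ev v a) (ev v b)

  ax-⇔-elimʳ : ∀ (a b : Form n) → Ax ((a ⇔' b) ⇒ (b ⇒ a))
  ax-⇔-elimʳ a b = taut λ v →
    bool-cases₂ (λ x y → ((x →ᵇ y) && (y →ᵇ x)) →ᵇ (y →ᵇ x))
      refl refl refl refl (ev v a) (ev v b)

  ax-contradiction-swap : ∀ (a b : Form n) → Ax ((a ∧' ~ a) ⇒ (b ∧' ~ b))
  ax-contradiction-swap a b = taut λ v →
    bool-cases₂ (λ x y → (x && not x) →ᵇ (y && not y)) refl refl refl refl (ev v a) (ev v b)

  weaken : (∀ ψ → T ψ → T' ψ) → T ⊢ φ → T' ⊢ φ
  weaken T⊆T' (hyp t) = hyp (T⊆T' _ t)
  weaken T⊆T' (ax a) = ax a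
  weaken T⊆T' (mp d e) = mp (weaken T⊆T' d) (weaken T⊆T' e)
  weaken T⊆T' (nec○ d) = nec○ d
  weaken T⊆T' (nec⊖ d) = nec⊖ d
  weaken T⊆T' (necK a d) = necK a d
  weaken T⊆T' (necP π p d) = necP π p d
  weaken T⊆T' (rU k B X α β ps) = rU k B X α β (λ i → weaken T⊆T' (ps i))
  weaken T⊆T' (rS k B X α β ps) = rS k B X α β (λ i → weaken T⊆T' (ps i))
  weaken T⊆T' (rC k B X α ps) = rC k B X α (λ i → weaken T⊆T' (ps i))
  weaken T⊆T' (arch π k B X α r pr pos ps) =
    arch π k B X α r pr pos (λ j pj h → weaken T⊆T' (ps j pj h))

  from-∅ : ∅ ⊢ φ → T ⊢ φ
  from-∅ = weaken (λ _ ())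

  explode : T ⊢ φ → T ⊢ ~ φ → ∀ ψ → T ⊢ ψ
  explode d e ψ = mp e (mp d (ax (ax-explosion _ ψ)))

  ⊤⇒-intro : T ⊢ φ → T ⊢ (⊤ᶠ ⇒ φ)
  ⊤⇒-intro d = mp d (ax (ax-K _ _))

  ⊤⇒-elim : T ⊢ (⊤ᶠ ⇒ φ) → T ⊢ φ
  ⊤⇒-elim d = mp (ax ax-⊤) d

  N-uncurry : ∀ k b bs X χ → T ⊢ (φ ⇒ N k (b ∷ bs) X χ) → T ⊢ N k ((φ ∧' b) ∷ bs) X χ
  N-uncurry zero b [] [] χ d = mp d (ax (ax-uncurry _ _ _))
  N-uncurry (suc k) b bs (x ∷ xs) χ d = mp d (ax (ax-uncurry _ _ _))

  N-curry : ∀ k b bs X χ → T ⊢ N k ((φ ∧' b) ∷ bs) X χ → T ⊢ (φ ⇒ N k (b ∷ bs) X χ)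
  N-curry zero b [] [] χ d = mp d (ax (ax-curry _ _ _))
  N-curry (suc k) b bs (x ∷ xs) χ d = mp d (ax (ax-curry _ _ _))

  deduction : Ext T φ ⊢ ψ → T ⊢ (φ ⇒ ψ)
  deduction (hyp (inj₁ t)) = mp (hyp t) (ax (ax-K _ _))
  deduction (hyp (inj₂ refl)) = ax (ax-I _)
  deduction (ax a) = mp (ax a) (ax (ax-K _ _))
  deduction (mp d e) = mp (deduction e) (mp (deduction d) (ax (ax-S _ _ _)))
  deduction (nec○ d) = mp (nec○ d) (ax (ax-K _ _))
  deduction (nec⊖ d) = mp (nec⊖ d) (ax (ax-K _ _))
  deduction (necK a d) = mp (necK a d) (ax (ax-K _ _))
  deduction (necP π p d) = mp (necP π p d) (ax (ax-K _ _))
  deduction {φ = φ} (rU k (b ∷ bs) X α β ps) =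
    N-curry k b bs X _ (rU k ((φ ∧' b) ∷ bs) X α β λ i →
      N-uncurry k b bs X _ (deduction (ps i)))
  deduction {φ = φ} (rS k (b ∷ bs) X α β ps) =
    N-curry k b bs X _ (rS k ((φ ∧' b) ∷ bs) X α β λ i →
      N-uncurry k b bs X _ (deduction (ps i)))
  deduction {φ = φ} (rC k (b ∷ bs) X α ps) =
    N-curry k b bs X _ (rC k ((φ ∧' b) ∷ bs) X α λ i →
      N-uncurry k b bs X _ (deduction (ps i)))
  deduction {φ = φ} (arch π k (b ∷ bs) X α r pr pos ps) =
    N-curry k b bs X _ (arch π k ((φ ∧' b) ∷ bs) X α r pr pos λ j pj h →
      N-uncurry k b bs X _ (deduction (ps j pj h)))

  refute : (∀ ψ → Ext T φ ⊢ ψ) → T ⊢ ~ φ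
  refute {φ = φ} all = mp (deduction (all (~ φ))) (ax (ax-self-refutation φ))

  applyOp-nec : ∀ x → ∅ ⊢ φ → T ⊢ applyOp x φ
  applyOp-nec (Kop a) = necK a
  applyOp-nec nxt = nec○
  applyOp-nec prv = nec⊖

  applyOp-dist : ∀ x a b → T ⊢ (applyOp x (a ⇒ b) ⇒ (applyOp x a ⇒ applyOp x b))
  applyOp-dist (Kop c) a b = ax (e1 c a b)
  applyOp-dist nxt a b = ax (t2 a b)
  applyOp-dist prv a b = ax (t6 a b)

  lift-⊢ : ∀ x → Preimage x T ⊢ φ → T ⊢ applyOp x φ
  lift-⊢ x (hyp t) = hyp t
  lift-⊢ x (ax a) = applyOp-nec x (ax a)
  lift-⊢ x (mp d e) = mp (lift-⊢ x d) (mp (lift-⊢ x e) (applyOp-dist x _ _))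
  lift-⊢ x (nec○ d) = applyOp-nec x (nec○ d)
  lift-⊢ x (nec⊖ d) = applyOp-nec x (nec⊖ d)
  lift-⊢ x (necK a d) = applyOp-nec x (necK a d)
  lift-⊢ x (necP π p d) = applyOp-nec x (necP π p d)
  lift-⊢ x (rU k B X α β ps) =
    ⊤⇒-elim (rU (suc k) (⊤ᶠ ∷ B) (x ∷ X) α β λ i → ⊤⇒-intro (lift-⊢ x (ps i)))
  lift-⊢ x (rS k B X α β ps) =
    ⊤⇒-elim (rS (suc k) (⊤ᶠ ∷ B) (x ∷ X) α β λ i → ⊤⇒-intro (lift-⊢ x (ps i)))
  lift-⊢ x (rC k B X α ps) =
    ⊤⇒-elim (rC (suc k) (⊤ᶠ ∷ B) (x ∷ X) α λ i → ⊤⇒-intro (lift-⊢ x (ps i)))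
  lift-⊢ x (arch π k B X α r pr pos ps) =
    ⊤⇒-elim (arch π (suc k) (⊤ᶠ ∷ B) (x ∷ X) α r pr pos λ j pj h →
      ⊤⇒-intro (lift-⊢ x (ps j pj h)))

  -- P_{≥s'} α refutes P_{≤s} α by axiom p2 (as s < s'), and ¬ P_{≤s} α gives P_{≥s} α by p3.
  P-antitone : ∀ π α s s' .(ps : InUnit s) .(ps' : InUnit s') → s ℚ.< s' →
               T ⊢ P π s' ps' α → T ⊢ P π s ps α
  P-antitone π α s s' ps ps' s<s' d =
    mp (mp d (mp (ax (p2 π α s s' (InUnit-complement ps) ps' s<s'))
                 (ax (ax-contraposition-¬ʳ _ _))))
       (mp (ax (p3 π α s ps (InUnit-complement ps))) (ax (ax-contraposition-¬ˡ _ _)))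

  ⊖^-suc : ∀ i (x : Form n) → ⊖^ i (⊖ x) ≡ ⊖ (⊖^ i x)
  ⊖^-suc zero x = refl
  ⊖^-suc (suc i) x = cong ⊖ (⊖^-suc i x)

  ⊖^-mono : ∀ j → ∅ ⊢ (φ ⇒ ψ) → ∅ ⊢ (⊖^ j φ ⇒ ⊖^ j ψ)
  ⊖^-mono zero d = d
  ⊖^-mono (suc j) d = mp (nec⊖ (⊖^-mono j d)) (ax (t6 _ _))

  conjs-last : ∀ (L : List (Form n)) φ → T ⊢ conjs L φ → T ⊢ φ
  conjs-last [] φ d = d
  conjs-last (x ∷ L) φ d = conjs-last L φ (mp d (ax (ax-∧-elimʳ _ _)))

  module MaxConsistentSet (T : Theory) (mc : MaxConsistent T) where

    private
      consistent : Consistent T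
      consistent = proj₁ mc

      maximal : ∀ T' → (∀ φ → T φ → T' φ) → Consistent T' → ∀ φ → T' φ → T φ
      maximal = proj₂ mc

    member-if-consistent : Consistent (Ext T φ) → T φ
    member-if-consistent {φ} c = maximal (Ext T φ) (λ _ → inj₁) c φ (inj₂ refl)

    closed : DeductivelyClosed T
    closed φ d = member-if-consistent λ all → consistent λ ψ → mp d (deduction (all ψ))

    derive : T ⊢ φ → T φ
    derive = closed _

    not-both : ∀ α → ¬ (T α × T (~ α))
    not-both α (t , t̄) = consistent (explode (hyp t) (hyp t̄))

    ∧-member : ∀ α β → T (α ∧' β) ⇔ (T α × T β)
    ∧-member α β = mk⇔
      (λ t → derive (mp (hyp t) (ax (ax-∧-elimˡ _ _))) , derive (mp (hyp t) (ax (ax-∧-elimʳ _ _))))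
      (λ (a , b) → derive (mp (hyp b) (mp (hyp a) (ax (ax-∧-intro _ _)))))

    contradiction-swap : ∀ j α β → T (⊖^ j (α ∧' ~ α)) → T (⊖^ j (β ∧' ~ β))
    contradiction-swap j α β t =
      derive (mp (hyp t) (from-∅ (⊖^-mono j (ax (ax-contradiction-swap α β)))))

    ⇔-member : T ⊢ (φ ⇔' ψ) → T φ ⇔ T ψ
    ⇔-member d = mk⇔ (λ t → derive (mp (hyp t) (mp d (ax (ax-⇔-elimˡ _ _)))))
                     (λ t → derive (mp (hyp t) (mp d (ax (ax-⇔-elimʳ _ _)))))

    sup-attained : ∀ π α r (pr : InUnit r) → SupIs T π α r → T (P π r pr α)
    sup-attained π α r pr (_ , approx) with ℚ.<-cmp 0ℚ r
    ... | tri< 0<r _ _ = derive (⊤⇒-elim (arch π 0 (⊤ᶠ ∷ []) [] α r pr 0<r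
          λ j pj _ → ⊤⇒-intro (approximant j pj)))
      where
      approximant : ∀ j .(pj : InUnit (r ℚ.- (+ 1 ℚ./ suc j))) →
                    T ⊢ P π (r ℚ.- (+ 1 ℚ./ suc j)) pj α
      approximant j pj with approx _ (p-1/[1+j]<p r j)
      ... | s , (ps , t) , lt = P-antitone π α _ s pj ps lt (hyp t)
    ... | tri≈ _ refl _ = derive (ax (p1 π α pr))
    ... | tri> _ _ r<0 = ⊥-elim (ℚ.<-irrefl refl (ℚ.<-≤-trans r<0 (proj₁ pr)))

    below-sup : ∀ π α s (ps : InUnit s) → BelowSup T π α s → T (P π s ps α)
    below-sup π α s ps (s' , (ps' , t) , s<s') = derive (P-antitone π α s s' ps ps' s<s' (hyp t))

    module _ (em : ExcludedMiddle (lsuc 0ℓ)) where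

      complete : ∀ α → T α ⊎ T (~ α)
      complete α with em {∀ ψ → Ext T α ⊢ ψ}
      ... | yes all = inj₂ (derive (refute all))
      ... | no c = inj₁ (member-if-consistent c)

      preimage-maximal : ∀ x → (∀ φ → T (~ applyOp x φ) → T (applyOp x (~ φ))) →
                         Consistent (Preimage x T) → MaxConsistent (Preimage x T)
      preimage-maximal x negate c = c , maximal′
        where
        maximal′ : ∀ T' → (∀ φ → Preimage x T φ → T' φ) → Consistent T' →
                   ∀ φ → T' φ → Preimage x T φ
        maximal′ T' sub c' φ t' with complete (applyOp x φ)
        ... | inj₁ t = t
        ... | inj₂ t̄ = ⊥-elim (c' (explode (hyp t') (hyp (sub (~ φ) (negate φ t̄)))))

      next-maximal : MaxConsistent (Preimage nxt T)
      next-maximal = preimage-maximal nxt negate-○ consistent-○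
        where
        negate-○ : ∀ φ → T (~ ○ φ) → T (○ (~ φ))
        negate-○ φ = Equivalence.to (⇔-member (ax (t1 φ)))
        consistent-○ : Consistent (Preimage nxt T)
        consistent-○ all = consistent (explode (lift-⊢ nxt (all ⊥ᶠ))
          (mp (nec○ (ax ax-⊤)) (mp (ax (t1 ⊥ᶠ)) (ax (ax-⇔-elimʳ _ _)))))

      module _ (no-start : ∀ α → ¬ T (⊖ (α ∧' ~ α))) where

        prev-maximal : MaxConsistent (Preimage prv T)
        prev-maximal = preimage-maximal prv negate-⊖ λ all →
          no-start (var 0) (derive (lift-⊢ prv (all ⊥ᶠ)))
          where
          negate-⊖ : ∀ φ → T (~ ⊖ φ) → T (⊖ (~ φ))
          negate-⊖ φ t =
            derive (mp (mp (hyp t) (mp ⊖¬¬φ⇒⊖φ (ax (ax-contraposition _ _)))) (ax (t5 (~ φ))))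
            where
            ⊖¬¬φ⇒⊖φ : T ⊢ (⊖ (~ ~ φ) ⇒ ⊖ φ)
            ⊖¬¬φ⇒⊖φ = mp (nec⊖ (ax (ax-¬¬-elim φ))) (ax (t6 _ _))

        ⊖○-member : ∀ α → T α ⇔ T (⊖ (○ α))
        ⊖○-member α =
          ⇔-member (mp (hyp ¬⊖⊥) (ax (t10 α (var 0)))) ⇔-∘ ⇔-sym (⇔-member (ax (t8 α)))
          where
          ¬⊖⊥ : T (~ ⊖ ⊥ᶠ)
          ¬⊖⊥ with complete (⊖ ⊥ᶠ)
          ... | inj₁ t = ⊥-elim (no-start (var 0) t)
          ... | inj₂ t̄ = t̄

      K-preimage-consistent : ∀ a α → ¬ T (K a α) → Consistent (Ext (Preimage (Kop a) T) (~ α))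
      K-preimage-consistent a α ¬Kα all =
        ¬Kα (derive (lift-⊢ (Kop a) (mp (refute all) (ax (ax-¬¬-elim α)))))

      -- Were no instance of the premise of rule RS for (⊖⊥ → ⊖⊥) S ⊖⊥ in T, all their
      -- negations would be, and RS would refute the axiom t12.
      some-⊖^⊥ : Σ ℕ (λ i → T (⊖^ i ⊥ᶠ))
      some-⊖^⊥ with decide em (Σ ℕ (λ i → T (premS i (⊖ ⊥ᶠ ⇒ ⊖ ⊥ᶠ) (⊖ ⊥ᶠ))))
      ... | yes (i , t) = suc i , subst T (⊖^-suc i ⊥ᶠ) (derive (conjs-last _ _ (hyp t)))
      ... | no none = ⊥-elim (consistent (explode (ax (t12 ⊥ᶠ))
            (⊤⇒-elim (rS 0 (⊤ᶠ ∷ []) [] _ _ λ i → ⊤⇒-intro (hyp (refuted i))))))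
        where
        refuted : ∀ i → T (~ premS i (⊖ ⊥ᶠ ⇒ ⊖ ⊥ᶠ) (⊖ ⊥ᶠ))
        refuted i with complete (premS i (⊖ ⊥ᶠ ⇒ ⊖ ⊥ᶠ) (⊖ ⊥ᶠ))
        ... | inj₁ t = ⊥-elim (none (i , t))
        ... | inj₂ t̄ = t̄

      start-depth : Σ ℕ (λ i → (0 < i)
          × (∀ α → T (⊖^ i (α ∧' ~ α)))
          × (∀ j → j < i → ∀ α → ¬ T (⊖^ j (α ∧' ~ α))))
      start-depth with some-⊖^⊥
      ... | m , t with least-witness (λ j → decide em (T (⊖^ j ⊥ᶠ))) m t
      ...   | zero , t₀ , _ = ⊥-elim (not-both (var 0) (Equivalence.to (∧-member _ _) t₀))
      ...   | suc i , tᵢ , below = suc i , z<s ,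
              (λ α → contradiction-swap (suc i) (var 0) α tᵢ) ,
              (λ j j<i α t → below j j<i (contradiction-swap j α (var 0) t))

lemma2 : ExcludedMiddle (lsuc 0ℓ) →
    ∀ {n} (T : Form n → Set) → MaxConsistent T →
    (∀ α → (T α ⊎ T (~ α)) × ¬ (T α × T (~ α)))
    × DeductivelyClosed T
    × (∀ α β → T (α ∧' β) ⇔ (T α × T β))
    × (∀ α β → T α → T (α ⇒ β) → T β)
    × (∀ k B X α β → (∀ i → T (N k B X (~ premU i α β))) → T (N k B X (~ (α U β))))
    × (∀ k B X α β → (∀ i → T (N k B X (~ premS i α β))) → T (N k B X (~ (α S β))))
    × (∀ k B X α → (∀ i → T (N k B X (E^ i α))) → T (N k B X (C α)))
    × (∀ π α r (pr : InUnit r) → SupIs T π α r → T (P π r pr α))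
    × (∀ π α s (ps : InUnit s) → BelowSup T π α s → T (P π s ps α))
    × Σ ℕ (λ i → (0 < i)
    × (∀ α → T (⊖^ i (α ∧' ~ α)))
    × (∀ j → j < i → ∀ α → ¬ T (⊖^ j (α ∧' ~ α))))
    × MaxConsistent (λ α → T (○ α))
    × ((∀ α → ¬ T (⊖ (α ∧' ~ α))) → MaxConsistent (λ α → T (⊖ α)))
    × ((∀ α → ¬ T (⊖ (α ∧' ~ α))) → ∀ α → T α ⇔ T (⊖ (○ α)))
    × (∀ a α → ¬ T (K a α) → Consistent (λ β → T (K a β) ⊎ (β ≡ ~ α)))
lemma2 em T mc =
  (λ α → complete em α , not-both α) ,
  closed ,
  ∧-member ,
  (λ α β a a⇒b → derive (mp (hyp a) (hyp a⇒b))) ,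
  (λ k B X α β h → derive (rU k B X α β (λ i → hyp (h i)))) ,
  (λ k B X α β h → derive (rS k B X α β (λ i → hyp (h i)))) ,
  (λ k B X α h → derive (rC k B X α (λ i → hyp (h i)))) ,
  sup-attained ,
  below-sup ,
  start-depth em ,
  next-maximal em ,
  prev-maximal em ,
  ⊖○-member em ,
  K-preimage-consistent em
  where open MaxConsistentSet T mc
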